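{- Let $w$ be an infinite word. Let $n'<n''$ be two consecutive lengths of palindromic prefixes of $w$ (i.e. $w$ has no palindromic prefix of length strictly between $n'$ and $n''$), let $\pi',\pi''$ be the corresponding prefixes, and let $\omega$ be the word with $\pi''=\pi'\omega$. Then every palindromic prefix $\pi$ of $w$ with $n'\le|\pi|\le n'+n''$ can be written $\pi=\pi'\omega^t$ for some integer $t\ge0$.
   Context: The empty word is considered a palindrome and a prefix of every word. -}

module Defs where

open import Data.Nat using (ℕ; zero; suc)
open import Data.List using (List; []; _∷_; reverse; _++_; concat; replicate; drop)
open import Relation.Binary.PropositionalEquality using (_≡_)

InfWord : Set → Set
InfWord A = ℕ → A

prefix : {A : Set} → InfWord A → ℕ → List A
prefix w zero    = []
prefix w (suc n) = w 0 ∷ prefix (λ i → w (suc i)) n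

IsPalindrome : {A : Set} → List A → Set
IsPalindrome u = reverse u ≡ u

_^ʷ_ : {A : Set} → List A → ℕ → List A
u ^ʷ t = concat (replicate t u)

{-# OPTIONS --safe #-}

-- A palindrome of length m with a palindromic prefix of length n has period
-- m − n, and conversely a period r of a palindrome of length m makes its prefix
-- of length m − r a palindrome. Write p = n′, d = n″ − n′. If p + d + e is a
-- palindromic prefix length with e ≤ p, the periods e and d + e coming from the
-- palindromic prefixes of lengths p + d and p combine to the period d. Hence
-- that prefix is π′ω followed by w[p, p + e), and the prefix of length p + e is
-- again palindromic. Descending in steps of d ends below p + d, where only p
-- itself is a palindromic prefix length.

module Submission where

open import Defs
open import Data.Nat using (ℕ; zero; suc; _≤_; _<_; _+_; _∸_; s≤s; z<s; s<s; _<?_)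
open import Data.Nat.Properties
open import Data.Nat.Induction using (<-wellFounded)
open import Data.Nat.Tactic.RingSolver using (solve-∀)
open import Data.List using (List; []; _∷_; _++_; drop; reverse; _∷ʳ_)
open import Data.List.Properties using (reverse-++; ∷-injective)
open import Data.Product using (∃; _,_; proj₁; proj₂)
open import Data.Empty using (⊥; ⊥-elim)
open import Function using (_∘_)
open import Induction.WellFounded using (Acc; acc)
open import Relation.Binary.PropositionalEquality
open import Relation.Nullary using (¬_; yes; no)

private
  variable
    A : Set
    v u : InfWord A
    a d e m n p r : ℕ

m<m+n⇒0<n : ∀ m → m < m + n → 0 < n
m<m+n⇒0<n zero    0<n       = 0<n
m<m+n⇒0<n (suc m) (s<s m<m+n) = m<m+n⇒0<n m m<m+n

shift : ℕ → InfWord A → InfWord A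
shift a v i = v (a + i)

prefix-+ : ∀ (v : InfWord A) a b → prefix v (a + b) ≡ prefix v a ++ prefix (shift a v) b
prefix-+ v zero    b = refl
prefix-+ v (suc a) b = cong (v 0 ∷_) (prefix-+ (shift 1 v) a b)

drop-prefix : ∀ (v : InfWord A) a b → drop a (prefix v (a + b)) ≡ prefix (shift a v) b
drop-prefix v zero    b = refl
drop-prefix v (suc a) b = drop-prefix (shift 1 v) a b

prefix-cong : ∀ n → (∀ i → i < n → v i ≡ u i) → prefix v n ≡ prefix u n
prefix-cong zero    eq = refl
prefix-cong (suc n) eq = cong₂ _∷_ (eq 0 z<s) (prefix-cong n (λ i i<n → eq (suc i) (s<s i<n)))

prefix-injective : ∀ n → prefix v n ≡ prefix u n → ∀ i → i < n → v i ≡ u i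
prefix-injective (suc n) eq zero    _         = proj₁ (∷-injective eq)
prefix-injective (suc n) eq (suc i) (s<s i<n) = prefix-injective n (proj₂ (∷-injective eq)) i i<n

prefix-∷ʳ : ∀ (v : InfWord A) n → prefix v (suc n) ≡ prefix v n ∷ʳ v n
prefix-∷ʳ v n = begin
  prefix v (suc n)                     ≡⟨ cong (prefix v) (+-comm 1 n) ⟩
  prefix v (n + 1)                     ≡⟨ prefix-+ v n 1 ⟩
  prefix v n ++ v (n + 0) ∷ []         ≡⟨ cong (λ k → prefix v n ∷ʳ v k) (+-identityʳ n) ⟩
  prefix v n ∷ʳ v n                    ∎
  where open ≡-Reasoning

reverse-prefix : ∀ (v : InfWord A) n → reverse (prefix v n) ≡ prefix (λ i → v (n ∸ suc i)) n
reverse-prefix v zero    = refl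
reverse-prefix v (suc n) = begin
  reverse (prefix v (suc n))           ≡⟨ cong reverse (prefix-∷ʳ v n) ⟩
  reverse (prefix v n ∷ʳ v n)          ≡⟨ reverse-++ (prefix v n) (v n ∷ []) ⟩
  v n ∷ reverse (prefix v n)           ≡⟨ cong (v n ∷_) (reverse-prefix v n) ⟩
  v n ∷ prefix (λ i → v (n ∸ suc i)) n ∎
  where open ≡-Reasoning

-- Both predicates are about the prefix of length n; Palindromic pairs the mirror
-- positions i and j = n − 1 − i without truncated subtraction.
Palindromic : InfWord A → ℕ → Set
Palindromic v n = ∀ i j → suc (i + j) ≡ n → v i ≡ v j

HasPeriod : InfWord A → ℕ → ℕ → Set
HasPeriod v n r = ∀ i → i + r < n → v i ≡ v (i + r)

isPalindrome⇒palindromic : ∀ n → IsPalindrome (prefix v n) → Palindromic v n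
isPalindrome⇒palindromic {v = v} .(suc (i + j)) pal i j refl = begin
  v i                       ≡⟨ prefix-injective {v = v} {u = λ k → v (i + j ∸ k)} _ pal′ i (s≤s (m≤m+n i j)) ⟩
  v (i + j ∸ i)             ≡⟨ cong v (m+n∸m≡n i j) ⟩
  v j                       ∎
  where
  open ≡-Reasoning
  pal′ : prefix v (suc (i + j)) ≡ prefix (λ k → v (i + j ∸ k)) (suc (i + j))
  pal′ = trans (sym pal) (reverse-prefix v (suc (i + j)))

palindromic⇒isPalindrome : ∀ n → Palindromic v n → IsPalindrome (prefix v n)
palindromic⇒isPalindrome {v = v} n pal = trans (reverse-prefix v n)
  (prefix-cong n (λ i i<n → sym (pal i (n ∸ suc i) (m+[n∸m]≡n i<n))))

palindromic-prefix⇒period : n + r ≡ m → Palindromic v m → Palindromic v n → HasPeriod v m r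
palindromic-prefix⇒period {n = n} {r = r} refl pal-m pal-n i i+r<m
  with m≤n⇒∃[o]m+o≡n (+-cancelʳ-< r i n i+r<m)
... | j , refl = trans (pal-n i j refl) (pal-m j (i + r) (cong suc j+[i+r]≡i+j+r))
  where
  j+[i+r]≡i+j+r : j + (i + r) ≡ i + j + r
  j+[i+r]≡i+j+r = trans (sym (+-assoc j i r)) (cong (_+ r) (+-comm j i))

period⇒palindromic-prefix : n + r ≡ m → Palindromic v m → HasPeriod v m r → Palindromic v n
period⇒palindromic-prefix {r = r} refl pal-m per i j refl =
  trans (pal-m i (j + r) (cong suc (sym (+-assoc i j r))))
        (sym (per j (+-monoˡ-< r (s≤s (m≤n+m j i)))))

-- A step by d is a step forward by d + a and back by a, or back by a and then
-- forward by d + a; the length bound keeps one of the two routes inside the word.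
period-difference : HasPeriod v n a → HasPeriod v n (d + a) → a + (d + a) ≤ n → HasPeriod v n d
period-difference {v = v} {n = n} {a = a} {d = d} per-a per-da a+[d+a]≤n i i+d<n with a ≤? i
... | no a≰i = begin
  v i                  ≡⟨ per-da i i+[d+a]<n ⟩
  v (i + (d + a))      ≡⟨ cong v (+-assoc i d a) ⟨
  v (i + d + a)        ≡⟨ per-a (i + d) (subst (_< n) (sym (+-assoc i d a)) i+[d+a]<n) ⟨
  v (i + d)            ∎
  where
  open ≡-Reasoning
  i+[d+a]<n : i + (d + a) < n
  i+[d+a]<n = <-≤-trans (+-monoˡ-< (d + a) (≰⇒> a≰i)) a+[d+a]≤n
... | yes a≤i with m≤n⇒∃[o]m+o≡n a≤i
...   | k , refl = begin
  v (a + k)            ≡⟨ cong v (+-comm a k) ⟩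
  v (k + a)            ≡⟨ per-a k (≤-<-trans (+-monoʳ-≤ k (m≤n+m a d)) k+[d+a]<n) ⟨
  v k                  ≡⟨ per-da k k+[d+a]<n ⟩
  v (k + (d + a))      ≡⟨ cong v (rearrange a k d) ⟨
  v (a + k + d)        ∎
  where
  open ≡-Reasoning
  rearrange : ∀ a k d → a + k + d ≡ k + (d + a)
  rearrange = solve-∀
  k+[d+a]<n : k + (d + a) < n
  k+[d+a]<n = subst (_< n) (rearrange a k d) i+d<n

palindromic-prefixes⇒period : Palindromic v p → Palindromic v (p + d) → e ≤ p →
                              Palindromic v (p + (d + e)) → HasPeriod v (p + (d + e)) d
palindromic-prefixes⇒period {v = v} {p = p} {d = d} {e = e} pal-p pal-q e≤p pal-m =
  period-difference per-e per-de (+-monoˡ-≤ (d + e) e≤p)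
  where
  per-e : HasPeriod v (p + (d + e)) e
  per-e = palindromic-prefix⇒period (+-assoc p d e) pal-m pal-q
  per-de : HasPeriod v (p + (d + e)) (d + e)
  per-de = palindromic-prefix⇒period refl pal-m pal-p

hasPeriod-shift : HasPeriod v (a + n) r → HasPeriod (shift a v) n r
hasPeriod-shift {v = v} {a = a} {n = n} {r = r} per i i+r<n =
  trans (per (a + i) (subst (_< a + n) (sym (+-assoc a i r)) (+-monoʳ-< a i+r<n)))
        (cong v (+-assoc a i r))

period⇒prefix-++ : ∀ (v : InfWord A) d n → HasPeriod v (d + n) d →
                   prefix v (d + n) ≡ prefix v d ++ prefix v n
period⇒prefix-++ v d n per = trans (prefix-+ v d n) (cong (prefix v d ++_) (prefix-cong n shift-d≗id))
  where
  shift-d≗id : ∀ i → i < n → v (d + i) ≡ v i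
  shift-d≗id i i<n = trans (cong v (+-comm d i))
                           (sym (per i (subst (i + d <_) (+-comm n d) (+-monoˡ-< d i<n))))

palindromic-prefix-power : {w : InfWord A} → 0 < d →
  Palindromic w p → Palindromic w (p + d) →
  (∀ n → p < n → n < p + d → ¬ Palindromic w n) →
  ∀ e → e ≤ p + d → Palindromic w (p + e) →
  ∃ λ t → prefix (shift p w) e ≡ prefix (shift p w) d ^ʷ t
palindromic-prefix-power {A = A} {d = d} {p = p} {w = w} 0<d pal-p pal-q gap e = go e (<-wellFounded e)
  where
  go : ∀ e → Acc _<_ e → e ≤ p + d → Palindromic w (p + e) →
       ∃ λ t → prefix (shift p w) e ≡ prefix (shift p w) d ^ʷ t
  go e (acc smaller) e≤p+d pal-e with e <? d
  go zero    _ _ _     | yes _   = 0 , refl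
  go (suc e) _ _ pal-e | yes e<d = ⊥-elim (gap (p + suc e) (m<m+n p z<s) (+-monoʳ-< p e<d) pal-e)
  go e (acc smaller) e≤p+d pal-e | no e≮d with m≤n⇒∃[o]m+o≡n (≮⇒≥ e≮d)
  ... | e′ , refl = suc t , (begin
    prefix w′ (d + e′)              ≡⟨ period⇒prefix-++ w′ d e′ (hasPeriod-shift per) ⟩
    prefix w′ d ++ prefix w′ e′     ≡⟨ cong (prefix w′ d ++_) power ⟩
    prefix w′ d ++ prefix w′ d ^ʷ t ∎)
    where
    open ≡-Reasoning
    w′ : InfWord A
    w′ = shift p w
    e′≤p : e′ ≤ p
    e′≤p = +-cancelˡ-≤ d e′ p (subst (d + e′ ≤_) (+-comm p d) e≤p+d)
    per : HasPeriod w (p + (d + e′)) d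
    per = palindromic-prefixes⇒period pal-p pal-q e′≤p pal-e
    pal-e′ : Palindromic w (p + e′)
    pal-e′ = period⇒palindromic-prefix (trans (+-assoc p e′ d) (cong (p +_) (+-comm e′ d))) pal-e per
    t-power : ∃ λ t → prefix w′ e′ ≡ prefix w′ d ^ʷ t
    t-power = go e′ (smaller (m<n+m e′ 0<d)) (≤-trans e′≤p (m≤m+n p d)) pal-e′
    t = proj₁ t-power
    power = proj₂ t-power

lemma5p4 : {A : Set} (w : InfWord A) (n′ n″ : ℕ) →
    n′ < n″ →
    IsPalindrome (prefix w n′) →
    IsPalindrome (prefix w n″) →
    ((m : ℕ) → n′ < m → m < n″ → IsPalindrome (prefix w m) → ⊥) →
    (m : ℕ) → n′ ≤ m → m ≤ n′ + n″ → IsPalindrome (prefix w m) →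
    ∃ λ t → prefix w m ≡ prefix w n′ ++ (drop n′ (prefix w n″) ^ʷ t)
lemma5p4 w n′ n″ n′<n″ pal′ pal″ gap m n′≤m m≤n′+n″ pal
  with m≤n⇒∃[o]m+o≡n (<⇒≤ n′<n″) | m≤n⇒∃[o]m+o≡n n′≤m
... | d , refl | e , refl
  with palindromic-prefix-power (m<m+n⇒0<n n′ n′<n″)
         (isPalindrome⇒palindromic n′ pal′) (isPalindrome⇒palindromic (n′ + d) pal″)
         (λ n n′<n n<n″ → gap n n′<n n<n″ ∘ palindromic⇒isPalindrome n)
         e (+-cancelˡ-≤ n′ e (n′ + d) m≤n′+n″) (isPalindrome⇒palindromic (n′ + e) pal)
... | t , power = t , (begin
  prefix w (n′ + e)                                ≡⟨ prefix-+ w n′ e ⟩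
  prefix w n′ ++ prefix (shift n′ w) e             ≡⟨ cong (prefix w n′ ++_) power ⟩
  prefix w n′ ++ prefix (shift n′ w) d ^ʷ t        ≡⟨ cong (λ ω → prefix w n′ ++ ω ^ʷ t) (drop-prefix w n′ d) ⟨
  prefix w n′ ++ drop n′ (prefix w (n′ + d)) ^ʷ t  ∎)
  where open ≡-Reasoning
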